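{- Let $\mathcal{F}$ and $\mathcal{S}$ be two orthogonal Fano planes with point-set $\mathcal{V}$. Then for any block $\{a,b,c\}$ of $\mathcal{F}$ there exists a unique block $\{x,y,z\}$ of $\mathcal{S}$ disjoint from $\{a,b,c\}$. Also, for any $v\in\mathcal{V}$ there exist a unique block $\{a,b,c\}$ of $\mathcal{F}$ and a unique block $\{x,y,z\}$ of $\mathcal{S}$ such that $\{v\}\cup\{a,b,c\}\cup\{x,y,z\}$ is a partition of $\mathcal{V}$.
   Context: A Fano plane is a pair $(\mathcal{V},\mathcal{B})$ with $|\mathcal{V}|=7$ and $\mathcal{B}$ a collection of 3-subsets (blocks) such that every 2-subset of $\mathcal{V}$ lies in exactly one block. Two Fano planes on the same point-set are orthogonal if they have no block in common (for Fano planes this is equivalent to the general notion of orthogonal Steiner triple systems). -}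

module Defs where

open import Data.Nat using (ℕ)
open import Data.Fin using (Fin)
open import Data.Fin.Subset using (Subset; _∈_; _∩_; _∪_; ⊤; ⊥; ∣_∣; ⁅_⁆)
open import Data.Product using (_×_; ∃!)
open import Relation.Binary.PropositionalEquality using (_≡_; _≢_)
open import Data.Empty renaming (⊥ to Void)
open import Level using (0ℓ; suc)

-- Point set: 𝒱 = Fin 7 (any 7-element set, up to relabelling).
Point : Set
Point = Fin 7

PSet : Set
PSet = Subset 7

Disjoint : PSet → PSet → Set
Disjoint A B = A ∩ B ≡ ⊥

record FanoPlane : Set₁ where
  field
    IsBlock    : PSet → Set
    block-size : ∀ B → IsBlock B → ∣ B ∣ ≡ 3
    pair-unique : ∀ (x y : Point) → x ≢ y →
                  ∃! _≡_ (λ B → IsBlock B × (x ∈ B × y ∈ B))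

Orthogonal : FanoPlane → FanoPlane → Set
Orthogonal F S = ∀ B → FanoPlane.IsBlock F B → FanoPlane.IsBlock S B → Void

-- {v}, A, X form a partition of 𝒱 (pairwise disjoint, union everything).
-- (A and X are blocks, hence nonempty; {v} is nonempty.)
IsPartition3 : Point → PSet → PSet → Set
IsPartition3 v A X =
  Disjoint ⁅ v ⁆ A × Disjoint ⁅ v ⁆ X × Disjoint A X × (⁅ v ⁆ ∪ A ∪ X ≡ ⊤)

-- Encode each Fano plane by its Steiner quasigroup: x ∙ y is the third point of the line through
-- x ≢ y, and orthogonality of F and S says exactly that x ∘ y ≢ x • y.  Because 7 = 3 + 3 + 1, two
-- lines of a Fano plane always meet, and this yields Pasch's law (v ∙ a) ∙ (v ∙ b) = a ∙ b for v off
-- the line ab.  For an F-line {a, b, c}, Pasch makes {a • b, a • c, b • c} an S-line, disjoint from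
-- {a, b, c} by orthogonality; an S-line avoiding a, b, c meets the S-lines ab and ac in a • b and
-- a • c, so it is that line.  In a partition {v} ∪ A ∪ X, a point w ∈ A forces v ∘ w ∈ X and then
-- v • (v ∘ w) ∈ A, so A is determined by any one of its points; as two F-lines meet, A is unique.
-- For existence, an F-line meeting each S-line through v once is reflected by x ↦ v • x onto an
-- S-line, and walking alternately along F- and S-lines through v produces such an F-line.
module Submission where

open import Defs
open import Data.Product using (_×_; _,_; ∃!; proj₁; proj₂; ∃; ∃₂)
open import Relation.Binary.PropositionalEquality
  using (_≡_; _≢_; refl; sym; trans; cong; cong₂; subst; subst₂; module ≡-Reasoning)

open import Data.Empty using (⊥-elim)
open import Data.Fin using (Fin; zero; punchIn) renaming (_≟_ to _≟ᶠ_)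
open import Data.Fin.Properties using (¬∀⟶∃¬; punchInᵢ≢i)
open import Data.Fin.Subset using (Subset; _∈_; _∉_; _⊆_; _∩_; _∪_; ⊥; ∣_∣; ⁅_⁆; inside; outside)
open import Data.Fin.Subset.Properties
  using (_∈?_; x∈⁅x⁆; x∈⁅y⁆⇒x≡y; x∈p∪q⁻; x∈p∪q⁺; x∈p∩q⁻; x∈p∩q⁺; ∉⊥; ∈⊤; Empty-unique; nonempty?;
         ⊆-antisym; p⊆q⇒∣p∣≤∣q∣; p⊂q⇒∣p∣<∣q∣; ∣⁅x⁆∣≡1; ∣⊥∣≡0; ∣p∣≤n; ∣p∣≡n⇒p≡⊤)
open import Data.Nat using (ℕ; suc; _+_; _<_; s≤s; z≤n)
open import Data.Nat.Properties using (+-suc; +-comm; n<1+n; <⇒≱; <-irrefl; ≤⇒≯; ≤-refl)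
open import Data.Sum using (_⊎_; inj₁; inj₂; [_,_]′)
import Data.Sum as Sum
open import Data.Vec using (_∷_; [])
open import Data.Vec.Properties using (∷-injectiveʳ)
open import Function using (_∘′_; flip; id)
open import Relation.Nullary using (Dec; yes; no; contradiction)
open import Relation.Nullary.Decidable using (decidable-stable; _→-dec_)

private variable
  n : ℕ
  p q B : Subset n
  w x y z : Fin n

∣p∪q∣≡∣p∣+∣q∣ : ∀ (p q : Subset n) → p ∩ q ≡ ⊥ → ∣ p ∪ q ∣ ≡ ∣ p ∣ + ∣ q ∣
∣p∪q∣≡∣p∣+∣q∣ []            []            _  = refl
∣p∪q∣≡∣p∣+∣q∣ (inside  ∷ p) (inside  ∷ q) ()
∣p∪q∣≡∣p∣+∣q∣ (inside  ∷ p) (outside ∷ q) eq = cong suc (∣p∪q∣≡∣p∣+∣q∣ p q (∷-injectiveʳ eq))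
∣p∪q∣≡∣p∣+∣q∣ (outside ∷ p) (inside  ∷ q) eq =
  trans (cong suc (∣p∪q∣≡∣p∣+∣q∣ p q (∷-injectiveʳ eq))) (sym (+-suc ∣ p ∣ ∣ q ∣))
∣p∪q∣≡∣p∣+∣q∣ (outside ∷ p) (outside ∷ q) eq = ∣p∪q∣≡∣p∣+∣q∣ p q (∷-injectiveʳ eq)

∣q∣<∣p∣⇒∃∈p∉q : ∣ q ∣ < ∣ p ∣ → ∃ λ x → x ∈ p × x ∉ q
∣q∣<∣p∣⇒∃∈p∉q {n} {q} {p} ∣q∣<∣p∣
  with ¬∀⟶∃¬ n _ (λ x → x ∈? p →-dec x ∈? q) (λ p⊆q → <⇒≱ ∣q∣<∣p∣ (p⊆q⇒∣p∣≤∣q∣ (p⊆q _)))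
... | x , p⊈q = x , decidable-stable (x ∈? p) (p⊈q ∘′ flip contradiction) , λ x∈q → p⊈q (λ _ → x∈q)

disjoint⁺ : (∀ {x} → x ∈ p → x ∉ q) → p ∩ q ≡ ⊥
disjoint⁺ {p = p} {q = q} p∩q-empty =
  Empty-unique (λ (x , x∈p∩q) → let (x∈p , x∈q) = x∈p∩q⁻ p q x∈p∩q in p∩q-empty x∈p x∈q)

disjoint⁻ : p ∩ q ≡ ⊥ → x ∈ p → x ∉ q
disjoint⁻ {x = x} p∩q≡⊥ x∈p x∈q = ∉⊥ (subst (x ∈_) p∩q≡⊥ (x∈p∩q⁺ (x∈p , x∈q)))

∈∧∉⇒≢ : x ∈ p → y ∉ p → x ≢ y
∈∧∉⇒≢ x∈p y∉p refl = y∉p x∈p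

⁅x⁆∩⁅y⁆≡⊥ : x ≢ y → ⁅ x ⁆ ∩ ⁅ y ⁆ ≡ ⊥
⁅x⁆∩⁅y⁆≡⊥ {x = x} {y = y} x≢y =
  disjoint⁺ (λ w∈x w∈y → x≢y (trans (sym (x∈⁅y⁆⇒x≡y x w∈x)) (x∈⁅y⁆⇒x≡y y w∈y)))

∣⁅x⁆∪⁅y⁆∣≡2 : x ≢ y → ∣ ⁅ x ⁆ ∪ ⁅ y ⁆ ∣ ≡ 2
∣⁅x⁆∪⁅y⁆∣≡2 {x = x} {y = y} x≢y =
  trans (∣p∪q∣≡∣p∣+∣q∣ ⁅ x ⁆ ⁅ y ⁆ (⁅x⁆∩⁅y⁆≡⊥ x≢y)) (cong₂ _+_ (∣⁅x⁆∣≡1 x) (∣⁅x⁆∣≡1 y))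

∈-⁅x⁆∪⁅y⁆⁻ : w ∈ ⁅ x ⁆ ∪ ⁅ y ⁆ → w ≡ x ⊎ w ≡ y
∈-⁅x⁆∪⁅y⁆⁻ {x = x} {y = y} = Sum.map (x∈⁅y⁆⇒x≡y x) (x∈⁅y⁆⇒x≡y y) ∘′ x∈p∪q⁻ ⁅ x ⁆ ⁅ y ⁆

tri : Fin n → Fin n → Fin n → Subset n
tri x y z = ⁅ x ⁆ ∪ ⁅ y ⁆ ∪ ⁅ z ⁆

∈-tri⁻ : w ∈ tri x y z → w ≡ x ⊎ w ≡ y ⊎ w ≡ z
∈-tri⁻ {x = x} {y = y} {z = z} =
  Sum.map (x∈⁅y⁆⇒x≡y x) ∈-⁅x⁆∪⁅y⁆⁻ ∘′ x∈p∪q⁻ ⁅ x ⁆ (⁅ y ⁆ ∪ ⁅ z ⁆)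

∈-tri⁺ : w ≡ x ⊎ w ≡ y ⊎ w ≡ z → w ∈ tri x y z
∈-tri⁺ {w = w} (inj₁ refl)        = x∈p∪q⁺ (inj₁ (x∈⁅x⁆ w))
∈-tri⁺ {w = w} (inj₂ (inj₁ refl)) = x∈p∪q⁺ (inj₂ (x∈p∪q⁺ (inj₁ (x∈⁅x⁆ w))))
∈-tri⁺ {w = w} (inj₂ (inj₂ refl)) = x∈p∪q⁺ (inj₂ (x∈p∪q⁺ (inj₂ (x∈⁅x⁆ w))))

∉-tri : w ≢ x → w ≢ y → w ≢ z → w ∉ tri x y z
∉-tri w≢x w≢y w≢z = [ w≢x , [ w≢y , w≢z ]′ ]′ ∘′ ∈-tri⁻

∣tri∣≡3 : x ≢ y → x ≢ z → y ≢ z → ∣ tri x y z ∣ ≡ 3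
∣tri∣≡3 {x = x} {y = y} {z = z} x≢y x≢z y≢z = begin
  ∣ ⁅ x ⁆ ∪ ⁅ y ⁆ ∪ ⁅ z ⁆ ∣        ≡⟨ ∣p∪q∣≡∣p∣+∣q∣ ⁅ x ⁆ (⁅ y ⁆ ∪ ⁅ z ⁆) x∉yz ⟩
  ∣ ⁅ x ⁆ ∣ + ∣ ⁅ y ⁆ ∪ ⁅ z ⁆ ∣    ≡⟨ cong₂ _+_ (∣⁅x⁆∣≡1 x) (∣⁅x⁆∪⁅y⁆∣≡2 y≢z) ⟩
  3                                ∎
  where
  open ≡-Reasoning
  x∉yz : ⁅ x ⁆ ∩ (⁅ y ⁆ ∪ ⁅ z ⁆) ≡ ⊥
  x∉yz = disjoint⁺ λ w∈x → subst (_∉ ⁅ y ⁆ ∪ ⁅ z ⁆) (sym (x∈⁅y⁆⇒x≡y x w∈x))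
                              ([ x≢y , x≢z ]′ ∘′ ∈-⁅x⁆∪⁅y⁆⁻)

module _ {n} {B : Subset n} (∣B∣≡3 : ∣ B ∣ ≡ 3) where

  3-subset≡tri : x ∈ B → y ∈ B → z ∈ B → x ≢ y → x ≢ z → y ≢ z → B ≡ tri x y z
  3-subset≡tri {x = x} {y = y} {z = z} x∈B y∈B z∈B x≢y x≢z y≢z = ⊆-antisym B⊆tri tri⊆B
    where
    tri⊆B : tri x y z ⊆ B
    tri⊆B w∈tri with ∈-tri⁻ w∈tri
    ... | inj₁ refl        = x∈B
    ... | inj₂ (inj₁ refl) = y∈B
    ... | inj₂ (inj₂ refl) = z∈B
    B⊆tri : B ⊆ tri x y z
    B⊆tri {w} w∈B = decidable-stable (w ∈? tri x y z) λ w∉tri →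
      <-irrefl (trans (∣tri∣≡3 x≢y x≢z y≢z) (sym ∣B∣≡3)) (p⊂q⇒∣p∣<∣q∣ (tri⊆B , w , w∈B , w∉tri))

  3-subset-pair : ∃₂ λ x y → x ≢ y × x ∈ B × y ∈ B
  3-subset-pair
    with x , x∈B , _ ← ∣q∣<∣p∣⇒∃∈p∉q {q = ⊥} (subst₂ _<_ (sym (∣⊥∣≡0 n)) (sym ∣B∣≡3) (s≤s z≤n))
    with y , y∈B , y∉⁅x⁆ ←
           ∣q∣<∣p∣⇒∃∈p∉q {q = ⁅ x ⁆} (subst₂ _<_ (sym (∣⁅x⁆∣≡1 x)) (sym ∣B∣≡3) (s≤s (s≤s z≤n)))
    = x , y , (λ x≡y → y∉⁅x⁆ (subst (_∈ ⁅ x ⁆) x≡y (x∈⁅x⁆ x))) , x∈B , y∈B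

  3-subset-third : x ∈ B → y ∈ B → x ≢ y → ∃ λ z → z ≢ x × z ≢ y × B ≡ tri x y z
  3-subset-third {x = x} {y = y} x∈B y∈B x≢y
    with ∣q∣<∣p∣⇒∃∈p∉q (subst₂ _<_ (sym (∣⁅x⁆∪⁅y⁆∣≡2 x≢y)) (sym ∣B∣≡3) ≤-refl)
  ... | z , z∈B , z∉xy = z , z≢x , z≢y , 3-subset≡tri x∈B y∈B z∈B x≢y (z≢x ∘′ sym) (z≢y ∘′ sym)
    where
    z≢x = λ z≡x → z∉xy (x∈p∪q⁺ (inj₁ (subst (_∈ ⁅ x ⁆) (sym z≡x) (x∈⁅x⁆ x))))
    z≢y = λ z≡y → z∉xy (x∈p∪q⁺ (inj₂ (subst (_∈ ⁅ y ⁆) (sym z≡y) (x∈⁅x⁆ y))))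

∣p∣≡n⇒∉p-unique : {p : Subset (suc n)} → ∣ p ∣ ≡ n → x ∉ p → y ∉ p → x ≡ y
∣p∣≡n⇒∉p-unique {n} {x} {y} {p} ∣p∣≡n x∉p y∉p with x ≟ᶠ y
... | yes x≡y = x≡y
... | no  x≢y =
  contradiction (subst (suc n <_) (sym ∣p∪xy∣≡2+n) (n<1+n (suc n))) (≤⇒≯ (∣p∣≤n (p ∪ ⁅ x ⁆ ∪ ⁅ y ⁆)))
  where
  open ≡-Reasoning
  p∩xy≡⊥ : p ∩ (⁅ x ⁆ ∪ ⁅ y ⁆) ≡ ⊥
  p∩xy≡⊥ = disjoint⁺ λ w∈p → [ (λ { refl → x∉p w∈p }) , (λ { refl → y∉p w∈p }) ]′ ∘′ ∈-⁅x⁆∪⁅y⁆⁻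
  ∣p∪xy∣≡2+n : ∣ p ∪ ⁅ x ⁆ ∪ ⁅ y ⁆ ∣ ≡ 2 + n
  ∣p∪xy∣≡2+n = begin
    ∣ p ∪ ⁅ x ⁆ ∪ ⁅ y ⁆ ∣      ≡⟨ ∣p∪q∣≡∣p∣+∣q∣ p _ p∩xy≡⊥ ⟩
    ∣ p ∣ + ∣ ⁅ x ⁆ ∪ ⁅ y ⁆ ∣  ≡⟨ cong₂ _+_ ∣p∣≡n (∣⁅x⁆∪⁅y⁆∣≡2 x≢y) ⟩
    n + 2                       ≡⟨ +-comm n 2 ⟩
    2 + n                       ∎

partition⁺ : {v : Point} {A X : PSet} →
             v ∉ A → v ∉ X → Disjoint A X → ∣ A ∣ ≡ 3 → ∣ X ∣ ≡ 3 → IsPartition3 v A X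
partition⁺ {v} {A} {X} v∉A v∉X A∩X≡⊥ ∣A∣≡3 ∣X∣≡3 =
  singleton-disjoint v∉A , singleton-disjoint v∉X , A∩X≡⊥ , ∣p∣≡n⇒p≡⊤ ∣v∪A∪X∣≡7
  where
  open ≡-Reasoning
  singleton-disjoint : {Y : PSet} → v ∉ Y → ⁅ v ⁆ ∩ Y ≡ ⊥
  singleton-disjoint v∉Y = disjoint⁺ λ w∈⁅v⁆ → subst (_∉ _) (sym (x∈⁅y⁆⇒x≡y v w∈⁅v⁆)) v∉Y
  v∩A∪X≡⊥ : ⁅ v ⁆ ∩ (A ∪ X) ≡ ⊥
  v∩A∪X≡⊥ = singleton-disjoint ([ v∉A , v∉X ]′ ∘′ x∈p∪q⁻ A X)
  ∣v∪A∪X∣≡7 : ∣ ⁅ v ⁆ ∪ A ∪ X ∣ ≡ 7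
  ∣v∪A∪X∣≡7 = begin
    ∣ ⁅ v ⁆ ∪ A ∪ X ∣            ≡⟨ ∣p∪q∣≡∣p∣+∣q∣ ⁅ v ⁆ (A ∪ X) v∩A∪X≡⊥ ⟩
    ∣ ⁅ v ⁆ ∣ + ∣ A ∪ X ∣        ≡⟨ cong (_+ ∣ A ∪ X ∣) (∣⁅x⁆∣≡1 v) ⟩
    1 + ∣ A ∪ X ∣                ≡⟨ cong suc (∣p∪q∣≡∣p∣+∣q∣ A X A∩X≡⊥) ⟩
    1 + (∣ A ∣ + ∣ X ∣)          ≡⟨ cong₂ (λ a x → 1 + (a + x)) ∣A∣≡3 ∣X∣≡3 ⟩
    7                            ∎

module _ {v : Point} {A X : PSet} (part : IsPartition3 v A X) where

  partition-v∉A : v ∉ A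
  partition-v∉A = disjoint⁻ (proj₁ part) (x∈⁅x⁆ v)

  partition-v∉X : v ∉ X
  partition-v∉X = disjoint⁻ (proj₁ (proj₂ part)) (x∈⁅x⁆ v)

  private
    partition-∈ : ∀ x → x ≡ v ⊎ x ∈ A ⊎ x ∈ X
    partition-∈ x = Sum.map (x∈⁅y⁆⇒x≡y v) (x∈p∪q⁻ A X)
      (x∈p∪q⁻ ⁅ v ⁆ (A ∪ X) (subst (x ∈_) (sym (proj₂ (proj₂ (proj₂ part)))) ∈⊤))

  partition-∈X : x ≢ v → x ∉ A → x ∈ X
  partition-∈X {x = x} x≢v x∉A = [ ⊥-elim ∘′ x≢v , [ ⊥-elim ∘′ x∉A , id ]′ ]′ (partition-∈ x)

  partition-∈A : x ≢ v → x ∉ X → x ∈ A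
  partition-∈A {x = x} x≢v x∉X = [ ⊥-elim ∘′ x≢v , [ id , ⊥-elim ∘′ x∉X ]′ ]′ (partition-∈ x)

module Lines (P : FanoPlane) where
  open FanoPlane P

  private
    variable
      a b c v : Point
      C : PSet

    third-point : x ≢ y → ∃ λ z → z ≢ x × z ≢ y × IsBlock (tri x y z)
    third-point {x} {y} x≢y =
      let (B , (B-block , x∈B , y∈B) , _) = pair-unique x y x≢y
          (z , z≢x , z≢y , B≡xyz) = 3-subset-third (block-size B B-block) x∈B y∈B x≢y
      in z , z≢x , z≢y , subst IsBlock B≡xyz B-block

  -- x ∙ x = x is a junk value: every law below assumes x ≢ y.
  infixl 7 _∙_
  _∙_ : Point → Point → Point
  x ∙ y with x ≟ᶠ y
  ... | yes _   = x
  ... | no  x≢y = proj₁ (third-point x≢y)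

  line : Point → Point → PSet
  line x y = tri x y (x ∙ y)

  private
    ∙-spec : x ≢ y → x ∙ y ≢ x × x ∙ y ≢ y × IsBlock (line x y)
    ∙-spec {x} {y} x≢y with x ≟ᶠ y
    ... | yes x≡y  = contradiction x≡y x≢y
    ... | no  x≢y′ = proj₂ (third-point x≢y′)

  ∙-≢ˡ : x ≢ y → x ∙ y ≢ x
  ∙-≢ˡ = proj₁ ∘′ ∙-spec

  ∙-≢ʳ : x ≢ y → x ∙ y ≢ y
  ∙-≢ʳ = proj₁ ∘′ proj₂ ∘′ ∙-spec

  line-isBlock : x ≢ y → IsBlock (line x y)
  line-isBlock = proj₂ ∘′ proj₂ ∘′ ∙-spec

  x∈line : x ∈ line x y
  x∈line = ∈-tri⁺ (inj₁ refl)

  y∈line : y ∈ line x y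
  y∈line = ∈-tri⁺ (inj₂ (inj₁ refl))

  x∙y∈line : x ∙ y ∈ line x y
  x∙y∈line = ∈-tri⁺ (inj₂ (inj₂ refl))

  blocks-equal : IsBlock B → IsBlock C → x ∈ B → y ∈ B → x ∈ C → y ∈ C → x ≢ y → B ≡ C
  blocks-equal {x = x} {y = y} B-block C-block x∈B y∈B x∈C y∈C x≢y =
    let (_ , _ , unique) = pair-unique x y x≢y
    in trans (sym (unique (B-block , x∈B , y∈B))) (unique (C-block , x∈C , y∈C))

  block≡line : IsBlock B → x ∈ B → y ∈ B → x ≢ y → B ≡ line x y
  block≡line B-block x∈B y∈B x≢y = blocks-equal B-block (line-isBlock x≢y) x∈B y∈B x∈line y∈line x≢y

  x∈B∧y∈B⇒x∙y∈B : IsBlock B → x ∈ B → y ∈ B → x ≢ y → x ∙ y ∈ B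
  x∈B∧y∈B⇒x∙y∈B B-block x∈B y∈B x≢y = subst (_ ∈_) (sym (block≡line B-block x∈B y∈B x≢y)) x∙y∈line

  ∙-unique : IsBlock B → x ∈ B → y ∈ B → z ∈ B → x ≢ y → z ≢ x → z ≢ y → z ≡ x ∙ y
  ∙-unique B-block x∈B y∈B z∈B x≢y z≢x z≢y
    with ∈-tri⁻ (subst (_ ∈_) (block≡line B-block x∈B y∈B x≢y) z∈B)
  ... | inj₁ z≡x        = contradiction z≡x z≢x
  ... | inj₂ (inj₁ z≡y) = contradiction z≡y z≢y
  ... | inj₂ (inj₂ z≡t) = z≡t

  ∙-comm : ∀ x y → x ∙ y ≡ y ∙ x
  ∙-comm x y = by-cases (x ≟ᶠ y)
    where
    by-cases : Dec (x ≡ y) → x ∙ y ≡ y ∙ x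
    by-cases (yes refl) = refl
    by-cases (no x≢y)   =
      sym (∙-unique (line-isBlock y≢x) y∈line x∈line x∙y∈line x≢y (∙-≢ʳ y≢x) (∙-≢ˡ y≢x))
      where y≢x = x≢y ∘′ sym

  ∙-involutive : x ≢ y → x ∙ (x ∙ y) ≡ y
  ∙-involutive x≢y =
    sym (∙-unique (line-isBlock x≢y) x∈line x∙y∈line y∈line (∙-≢ˡ x≢y ∘′ sym) (x≢y ∘′ sym) (∙-≢ʳ x≢y ∘′ sym))

  ∙-cancelˡ : x ≢ y → x ≢ z → x ∙ y ≡ x ∙ z → y ≡ z
  ∙-cancelˡ {x} x≢y x≢z eq = trans (sym (∙-involutive x≢y)) (trans (cong (x ∙_) eq) (∙-involutive x≢z))

  x∈B∧y∉B⇒x∙y∉B : IsBlock B → x ∈ B → y ∉ B → x ∙ y ∉ B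
  x∈B∧y∉B⇒x∙y∉B {x = x} {y = y} B-block x∈B y∉B x∙y∈B =
    y∉B (subst (_∈ _) (∙-involutive x≢y) (x∈B∧y∈B⇒x∙y∈B B-block x∈B x∙y∈B (∙-≢ˡ x≢y ∘′ sym)))
    where x≢y = λ { refl → y∉B x∈B }

  ∙-swapʳ : x ≢ y → x ∙ y ≡ z → x ∙ z ≡ y
  ∙-swapʳ {x} x≢y refl = ∙-involutive x≢y

  ≢∙-swap : v ≢ y → y ≢ v ∙ x → x ≢ v ∙ y
  ≢∙-swap v≢y y≢v∙x x≡v∙y = y≢v∙x (sym (∙-swapʳ v≢y (sym x≡v∙y)))

  -- Two disjoint lines cover six points, which leaves room for only one of x ∙ u ≢ x ∙ w.
  blocks-not-disjoint : IsBlock B → IsBlock C → B ∩ C ≢ ⊥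
  blocks-not-disjoint {B = B} {C = C} B-block C-block B∩C≡⊥
    with x , _ , _ , x∈B , _ ← 3-subset-pair (block-size B B-block)
    with u , w , u≢w , u∈C , w∈C ← 3-subset-pair (block-size C C-block)
    = u≢w (∙-cancelˡ (x≢ u∈C) (x≢ w∈C) (∣p∣≡n⇒∉p-unique ∣B∪C∣≡6 (x∙-∉ u∈C) (x∙-∉ w∈C)))
    where
    x∉C = disjoint⁻ B∩C≡⊥ x∈B
    x≢ : y ∈ C → x ≢ y
    x≢ y∈C refl = x∉C y∈C
    x∙-∉ : y ∈ C → x ∙ y ∉ B ∪ C
    x∙-∉ {y} y∈C = [ x∈B∧y∉B⇒x∙y∉B B-block x∈B (λ y∈B → disjoint⁻ B∩C≡⊥ y∈B y∈C)
                   , subst (_∉ C) (∙-comm y x) (x∈B∧y∉B⇒x∙y∉B C-block y∈C x∉C) ]′ ∘′ x∈p∪q⁻ B C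
    ∣B∪C∣≡6 : ∣ B ∪ C ∣ ≡ 6
    ∣B∪C∣≡6 = trans (∣p∪q∣≡∣p∣+∣q∣ B C B∩C≡⊥) (cong₂ _+_ (block-size B B-block) (block-size C C-block))

  blocks-meet : IsBlock B → IsBlock C → ∃ λ w → w ∈ B × w ∈ C
  blocks-meet {B = B} {C = C} B-block C-block with nonempty? (B ∩ C)
  ... | yes (w , w∈B∩C) = w , x∈p∩q⁻ B C w∈B∩C
  ... | no  B∩C-empty  = contradiction (Empty-unique B∩C-empty) (blocks-not-disjoint B-block C-block)

  x∉B∧y∉B⇒x∙y∈B : IsBlock B → x ∉ B → y ∉ B → x ≢ y → x ∙ y ∈ B
  x∉B∧y∉B⇒x∙y∈B B-block x∉B y∉B x≢y with blocks-meet (line-isBlock x≢y) B-block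
  ... | w , w∈line , w∈B with ∈-tri⁻ w∈line
  ...   | inj₁ refl        = contradiction w∈B x∉B
  ...   | inj₂ (inj₁ refl) = contradiction w∈B y∉B
  ...   | inj₂ (inj₂ refl) = w∈B

  ∙-involutiveʳ : x ≢ y → (x ∙ y) ∙ y ≡ x
  ∙-involutiveʳ {x} {y} x≢y = trans (∙-comm (x ∙ y) y) (∙-swapʳ (x≢y ∘′ sym) (∙-comm y x))

  ∉-line⁻ : y ∉ line v x → y ≢ v × y ≢ x × y ≢ v ∙ x
  ∉-line⁻ y∉line = ∈∧∉⇒≢ x∈line y∉line ∘′ sym , ∈∧∉⇒≢ y∈line y∉line ∘′ sym , ∈∧∉⇒≢ x∙y∈line y∉line ∘′ sym

  pasch : a ≢ b → v ∉ line a b → (v ∙ a) ∙ (v ∙ b) ≡ a ∙ b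
  pasch {a} {b} {v} a≢b v∉ab =
    third (∈-tri⁻ (x∉B∧y∉B⇒x∙y∈B (line-isBlock a≢b) (v∙-∉ x∈line) (v∙-∉ y∈line) v∙a≢v∙b))
    where
    open ≡-Reasoning
    v≢a = proj₁ (∉-line⁻ v∉ab)
    v≢b = proj₁ (proj₂ (∉-line⁻ v∉ab))
    v∙a≢v∙b = a≢b ∘′ ∙-cancelˡ v≢a v≢b
    v∙-∉ : x ∈ line a b → v ∙ x ∉ line a b
    v∙-∉ {x} x∈ab = subst (_∉ _) (∙-comm x v) (x∈B∧y∉B⇒x∙y∉B (line-isBlock a≢b) x∈ab v∉ab)
    third : let t = (v ∙ a) ∙ (v ∙ b) in t ≡ a ⊎ t ≡ b ⊎ t ≡ a ∙ b → t ≡ a ∙ b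
    third (inj₁ t≡a) = ⊥-elim (∙-≢ˡ v≢b (begin
      v ∙ b            ≡⟨ sym (∙-swapʳ v∙a≢v∙b t≡a) ⟩
      (v ∙ a) ∙ a      ≡⟨ ∙-involutiveʳ v≢a ⟩
      v                ∎))
    third (inj₂ (inj₁ t≡b)) = ⊥-elim (∙-≢ˡ v≢a (begin
      v ∙ a            ≡⟨ sym (∙-swapʳ (v∙a≢v∙b ∘′ sym) (trans (∙-comm (v ∙ b) (v ∙ a)) t≡b)) ⟩
      (v ∙ b) ∙ b      ≡⟨ ∙-involutiveʳ v≢b ⟩
      v                ∎))
    third (inj₂ (inj₂ t≡ab)) = t≡ab

  ∈-line-sym : x ≢ v → y ≢ v → y ∈ line v x → x ∈ line v y
  ∈-line-sym x≢v y≢v y∈vx =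
    subst (_ ∈_) (block≡line (line-isBlock (x≢v ∘′ sym)) x∈line y∈vx (y≢v ∘′ sym)) y∈line

  -- a ∙ b lies on the line through v and c, which misses a and b; Pasch moves it to (v ∙ a) ∙ (v ∙ b).
  transversal-reflection : a ≢ v → b ∉ line v a → c ∉ line v a → c ∉ line v b → a ∙ b ≢ c →
                           (v ∙ a) ∙ (v ∙ b) ≡ v ∙ c
  transversal-reflection {a} {v} {b} {c} a≢v b∉va c∉va c∉vb ab≢c
    with b≢v , b≢a , b≢v∙a ← ∉-line⁻ b∉va
    with c≢v , _ , _ ← ∉-line⁻ c∉va
    = third (∈-tri⁻ (x∉B∧y∉B⇒x∙y∈B (line-isBlock (c≢v ∘′ sym)) a∉vc b∉vc (b≢a ∘′ sym)))
    where
    a∉vc = c∉va ∘′ ∈-line-sym c≢v a≢v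
    b∉vc = c∉vb ∘′ ∈-line-sym c≢v b≢v
    ab≢v : a ∙ b ≢ v
    ab≢v ab≡v = b≢v∙a (trans (sym (∙-swapʳ (b≢a ∘′ sym) ab≡v)) (∙-comm a v))
    third : a ∙ b ≡ v ⊎ a ∙ b ≡ c ⊎ a ∙ b ≡ v ∙ c → (v ∙ a) ∙ (v ∙ b) ≡ v ∙ c
    third (inj₁ ab≡v)         = contradiction ab≡v ab≢v
    third (inj₂ (inj₁ ab≡c))  = contradiction ab≡c ab≢c
    third (inj₂ (inj₂ ab≡vc)) =
      trans (pasch (b≢a ∘′ sym) (∉-tri (a≢v ∘′ sym) (b≢v ∘′ sym) (ab≢v ∘′ sym))) ab≡vc

  transversal-partition : a ≢ v → b ∉ line v a → c ∉ line v a → c ∉ line v b →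
                          IsPartition3 v (tri a b c) (tri (v ∙ a) (v ∙ b) (v ∙ c))
  transversal-partition {a} {v} {b} {c} a≢v b∉va c∉va c∉vb
    with b≢v , b≢a , b≢v∙a ← ∉-line⁻ b∉va
    with c≢v , c≢a , c≢v∙a ← ∉-line⁻ c∉va
    with _   , c≢b , c≢v∙b ← ∉-line⁻ c∉vb
    = partition⁺ (∉-tri (a≢v ∘′ sym) (b≢v ∘′ sym) (c≢v ∘′ sym))
                 (∉-tri (v≢v∙ a≢v) (v≢v∙ b≢v) (v≢v∙ c≢v))
                 (disjoint⁺ abc∌)
                 (∣tri∣≡3 (b≢a ∘′ sym) (c≢a ∘′ sym) (c≢b ∘′ sym))
                 (∣tri∣≡3 (v∙≢v∙ a≢v b≢v b≢a) (v∙≢v∙ a≢v c≢v c≢a) (v∙≢v∙ b≢v c≢v c≢b))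
    where
    v≢v∙ : x ≢ v → v ≢ v ∙ x
    v≢v∙ x≢v = ∙-≢ˡ (x≢v ∘′ sym) ∘′ sym
    x≢v∙ : x ≢ v → x ≢ v ∙ x
    x≢v∙ x≢v = ∙-≢ʳ (x≢v ∘′ sym) ∘′ sym
    v∙≢v∙ : x ≢ v → y ≢ v → y ≢ x → v ∙ x ≢ v ∙ y
    v∙≢v∙ x≢v y≢v y≢x = y≢x ∘′ sym ∘′ ∙-cancelˡ (x≢v ∘′ sym) (y≢v ∘′ sym)
    abc∌ : y ∈ tri a b c → y ∉ tri (v ∙ a) (v ∙ b) (v ∙ c)
    abc∌ y∈abc with ∈-tri⁻ y∈abc
    ... | inj₁ refl        = ∉-tri (x≢v∙ a≢v) (≢∙-swap (b≢v ∘′ sym) b≢v∙a) (≢∙-swap (c≢v ∘′ sym) c≢v∙a)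
    ... | inj₂ (inj₁ refl) = ∉-tri b≢v∙a (x≢v∙ b≢v) (≢∙-swap (c≢v ∘′ sym) c≢v∙b)
    ... | inj₂ (inj₂ refl) = ∉-tri c≢v∙a c≢v∙b (x≢v∙ c≢v)

module OrthogonalPair (F S : FanoPlane) (F⊥S : Orthogonal F S) where
  open FanoPlane F using () renaming (IsBlock to F-Block; block-size to F-block-size)
  open FanoPlane S using () renaming (IsBlock to S-Block)
  module F = Lines F
  module S = Lines S
  open F using () renaming (_∙_ to _∘_)
  open S using () renaming (_∙_ to _•_)

  private
    variable
      a b v : Point
      A A′ X X′ : PSet

  ∘≢• : x ≢ y → x ∘ y ≢ x • y
  ∘≢• {x} {y} x≢y x∘y≡x•y =
    F⊥S (F.line x y) (F.line-isBlock x≢y) (subst S-Block (cong (tri x y) (sym x∘y≡x•y)) (S.line-isBlock x≢y))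

  •∉F-block : F-Block A → x ∈ A → y ∈ A → x ≢ y → x • y ∉ A
  •∉F-block A-block x∈A y∈A x≢y x•y∈A =
    ∘≢• x≢y (sym (F.∙-unique A-block x∈A y∈A x•y∈A x≢y (S.∙-≢ˡ x≢y) (S.∙-≢ʳ x≢y)))

  module _ (a≢b : a ≢ b) where
    private
      c = a ∘ b
      a≢c = F.∙-≢ˡ a≢b ∘′ sym
      b≢c = F.∙-≢ʳ a≢b ∘′ sym
      p≢q : a • b ≢ a • c
      p≢q = b≢c ∘′ S.∙-cancelˡ a≢b a≢c

    disjoint-line : S-Block (S.line (a • b) (a • c)) × Disjoint (F.line a b) (S.line (a • b) (a • c))
    disjoint-line = S.line-isBlock p≢q
                  , disjoint⁺ λ w∈A → ∉-tri (∈∧∉⇒≢ w∈A a•b∉A) (∈∧∉⇒≢ w∈A a•c∉A)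
                                            (∈∧∉⇒≢ w∈A (subst (_∉ _) (sym p•q≡b•c) b•c∉A))
      where
      A-block = F.line-isBlock a≢b
      a•b∉A = •∉F-block A-block F.x∈line F.y∈line a≢b
      a•c∉A = •∉F-block A-block F.x∈line F.x∙y∈line a≢c
      b•c∉A = •∉F-block A-block F.y∈line F.x∙y∈line b≢c
      p•q≡b•c : (a • b) • (a • c) ≡ b • c
      p•q≡b•c = S.pasch b≢c (∉-tri a≢b a≢c (∈∧∉⇒≢ F.x∈line b•c∉A))

    disjoint-line-unique : S-Block X → Disjoint (F.line a b) X → X ≡ S.line (a • b) (a • c)
    disjoint-line-unique {X} X-block A∩X≡⊥ =
      S.block≡line X-block (•∈X F.x∈line F.y∈line a≢b) (•∈X F.x∈line F.x∙y∈line a≢c) p≢q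
      where
      •∈X : x ∈ F.line a b → y ∈ F.line a b → x ≢ y → x • y ∈ X
      •∈X x∈A y∈A = S.x∉B∧y∉B⇒x∙y∈B X-block (disjoint⁻ A∩X≡⊥ x∈A) (disjoint⁻ A∩X≡⊥ y∈A)

  disjoint-block : F-Block A → ∃! _≡_ λ X → S-Block X × Disjoint A X
  disjoint-block {A} A-block
    with a , b , a≢b , a∈A , b∈A ← 3-subset-pair (F-block-size A A-block)
    rewrite F.block≡line A-block a∈A b∈A a≢b
    = _ , disjoint-line a≢b
        , λ (X-block , A∩X≡⊥) → sym (disjoint-line-unique a≢b X-block A∩X≡⊥)

  Split : Point → PSet × PSet → Set
  Split v (A , X) = F-Block A × S-Block X × IsPartition3 v A X

  -- Along w ↦ v ∘ w ↦ v • (v ∘ w) the points alternate between A and X.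
  partition-line : F-Block A → S-Block X → IsPartition3 v A X → w ∈ A → A ≡ F.line w (v • (v ∘ w))
  partition-line {A} {X} {v} {w} A-block X-block part w∈A = F.block≡line A-block w∈A w′∈A w≢w′
    where
    v≢w : v ≢ w
    v≢w = ∈∧∉⇒≢ w∈A (partition-v∉A part) ∘′ sym
    v≢v∘w : v ≢ v ∘ w
    v≢v∘w = F.∙-≢ˡ v≢w ∘′ sym
    v∘w∈X : v ∘ w ∈ X
    v∘w∈X = partition-∈X part (F.∙-≢ˡ v≢w)
      (subst (_∉ A) (F.∙-comm w v) (F.x∈B∧y∉B⇒x∙y∉B A-block w∈A (partition-v∉A part)))
    w′∈A : v • (v ∘ w) ∈ A
    w′∈A = partition-∈A part (S.∙-≢ˡ v≢v∘w)
      (subst (_∉ X) (S.∙-comm (v ∘ w) v) (S.x∈B∧y∉B⇒x∙y∉B X-block v∘w∈X (partition-v∉X part)))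
    w≢w′ : w ≢ v • (v ∘ w)
    w≢w′ w≡w′ = ∘≢• v≢w (sym (S.∙-swapʳ v≢v∘w (sym w≡w′)))

  partition-unique : Split v (A , X) → Split v (A′ , X′) → (A , X) ≡ (A′ , X′)
  partition-unique {X = X} {X′ = X′} (A-block , X-block , part) (A′-block , X′-block , part′)
    with w , w∈A , w∈A′ ← F.blocks-meet A-block A′-block
    = cong₂ _,_ A≡A′ (trans (sym (X₀≡ (X-block , A∩X≡⊥))) (X₀≡ (X′-block , A∩X′≡⊥)))
    where
    A≡A′ = trans (partition-line A-block X-block part w∈A)
                 (sym (partition-line A′-block X′-block part′ w∈A′))
    X₀≡ = proj₂ (proj₂ (disjoint-block A-block))
    A∩X≡⊥ = proj₁ (proj₂ (proj₂ part))
    A∩X′≡⊥ = subst (λ B → Disjoint B X′) (sym A≡A′) (proj₁ (proj₂ (proj₂ part′)))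

  split-of-transversal : a ≢ v → b ∉ S.line v a → a ∘ b ∉ S.line v a → a ∘ b ∉ S.line v b →
                         Split v (F.line a b , tri (v • a) (v • b) (v • (a ∘ b)))
  split-of-transversal {a} {v} {b} a≢v b∉va c∉va c∉vb =
      F.line-isBlock a≢b
    , subst S-Block
        (cong (tri (v • a) (v • b)) (S.transversal-reflection a≢v b∉va c∉va c∉vb (∘≢• a≢b ∘′ sym)))
        (S.line-isBlock (a≢b ∘′ S.∙-cancelˡ (a≢v ∘′ sym) (b≢v ∘′ sym)))
    , S.transversal-partition a≢v b∉va c∉va c∉vb
    where
    b≢v = proj₁ (S.∉-line⁻ b∉va)
    a≢b = proj₁ (proj₂ (S.∉-line⁻ b∉va)) ∘′ sym

  -- Walk from x₀ alternately along F- and S-lines through v.  By Pasch t = x₀ ∘ x₂ = x₁ ∘ x₃, and the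
  -- F-line {x₁, x₃, t} (if t ≢ x₄) or {x₀, x₂, t} (if t ≡ x₄) meets each S-line through v once.
  module _ (v : Point) where
    private
      x₀ x₁ x₂ x₃ x₄ t : Point
      x₀ = punchIn v zero
      x₁ = v ∘ x₀
      x₂ = v • x₁
      x₃ = v ∘ x₂
      x₄ = v • x₃
      t  = x₀ ∘ x₂

      v≢x₀ : v ≢ x₀
      v≢x₀ = punchInᵢ≢i v zero ∘′ sym
      v≢x₁ : v ≢ x₁
      v≢x₁ = F.∙-≢ˡ v≢x₀ ∘′ sym
      v≢x₂ : v ≢ x₂
      v≢x₂ = S.∙-≢ˡ v≢x₁ ∘′ sym
      v≢x₃ : v ≢ x₃
      v≢x₃ = F.∙-≢ˡ v≢x₂ ∘′ sym
      x₁≢x₀ : x₁ ≢ x₀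
      x₁≢x₀ = F.∙-≢ʳ v≢x₀
      x₂≢x₁ : x₂ ≢ x₁
      x₂≢x₁ = S.∙-≢ʳ v≢x₁
      x₃≢x₂ : x₃ ≢ x₂
      x₃≢x₂ = F.∙-≢ʳ v≢x₂
      x₂≢x₀ : x₂ ≢ x₀
      x₂≢x₀ x₂≡x₀ = ∘≢• v≢x₁ (trans (F.∙-involutive v≢x₀) (sym x₂≡x₀))
      x₃≢x₁ : x₃ ≢ x₁
      x₃≢x₁ x₃≡x₁ = ∘≢• v≢x₂ (trans x₃≡x₁ (sym (S.∙-involutive v≢x₁)))
      x₃≢x₀ : x₃ ≢ x₀
      x₃≢x₀ x₃≡x₀ = x₂≢x₁ (sym (F.∙-swapʳ v≢x₂ x₃≡x₀))
      t≢v : t ≢ v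
      t≢v t≡v = x₂≢x₁ (sym (trans (F.∙-comm v x₀) (F.∙-swapʳ (x₂≢x₀ ∘′ sym) t≡v)))
      t≢x₀ : t ≢ x₀
      t≢x₀ = F.∙-≢ˡ (x₂≢x₀ ∘′ sym)
      t≢x₂ : t ≢ x₂
      t≢x₂ = F.∙-≢ʳ (x₂≢x₀ ∘′ sym)
      x₁∘x₃≡t : x₁ ∘ x₃ ≡ t
      x₁∘x₃≡t = F.pasch (x₂≢x₀ ∘′ sym) (∉-tri v≢x₀ v≢x₂ (t≢v ∘′ sym))
      t≢x₁ : t ≢ x₁
      t≢x₁ = F.∙-≢ˡ (x₃≢x₁ ∘′ sym) ∘′ trans x₁∘x₃≡t
      t≢x₃ : t ≢ x₃
      t≢x₃ = F.∙-≢ʳ (x₃≢x₁ ∘′ sym) ∘′ trans x₁∘x₃≡t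

    partition-exists : ∃ (Split v)
    partition-exists with t ≟ᶠ x₄
    ... | no t≢x₄ = _ , split-of-transversal (v≢x₁ ∘′ sym) (∉-tri (v≢x₃ ∘′ sym) x₃≢x₁ x₃≢x₂)
                          (subst (_∉ S.line v x₁) (sym x₁∘x₃≡t) (∉-tri t≢v t≢x₁ t≢x₂))
                          (subst (_∉ S.line v x₃) (sym x₁∘x₃≡t) (∉-tri t≢v t≢x₃ t≢x₄))
    ... | yes t≡x₄ = _ , split-of-transversal (v≢x₀ ∘′ sym) (∉-tri (v≢x₂ ∘′ sym) x₂≢x₀ x₂≢v•x₀)
                           (∉-tri t≢v t≢x₀ t≢v•x₀) (∉-tri t≢v t≢x₂ t≢v•x₂)
      where
      v•x₂≡x₁ : v • x₂ ≡ x₁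
      v•x₂≡x₁ = S.∙-involutive v≢x₁
      x₂≢v•x₀ : x₂ ≢ v • x₀
      x₂≢v•x₀ = S.≢∙-swap v≢x₀ (x₁≢x₀ ∘′ sym ∘′ flip trans v•x₂≡x₁)
      t≢v•x₀ : t ≢ v • x₀
      t≢v•x₀ = S.≢∙-swap v≢x₀ (x₃≢x₀ ∘′ sym ∘′ flip trans (trans (cong (v •_) t≡x₄) (S.∙-involutive v≢x₃)))
      t≢v•x₂ : t ≢ v • x₂
      t≢v•x₂ = t≢x₁ ∘′ flip trans v•x₂≡x₁

lemma3p1 : (F S : FanoPlane) → Orthogonal F S →
    ((A : PSet) → FanoPlane.IsBlock F A →
       ∃! _≡_ (λ X → FanoPlane.IsBlock S X × Disjoint A X))
    × ((v : Point) →
       ∃! _≡_ (λ (AX : PSet × PSet) →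
         FanoPlane.IsBlock F (proj₁ AX) × FanoPlane.IsBlock S (proj₂ AX)
           × IsPartition3 v (proj₁ AX) (proj₂ AX)))
lemma3p1 F S F⊥S = (λ _ → disjoint-block) , λ v →
  let (AX , split) = partition-exists v in AX , split , partition-unique split
  where open OrthogonalPair F S F⊥S
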